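{- Let $n$ be a positive integer and consider the random $1$-Naples parking model with $p=1/2$. For every integer $t$ with $1\le t\le 2^{n-2}$ there is exactly one $\alpha\in\{1,2,\ldots,n\}^n$ such that $\mathbb{P}(\alpha\text{ parks})=\frac{2t-1}{2^{n-1}}$.
   Context: Random $1$-Naples parking model with $p=1/2$: there are parking spots $1,\ldots,n$ in a line and $n$ cars $C_1,\ldots,C_n$ arriving in order, car $C_i$ preferring spot $\alpha_i\in\{1,\ldots,n\}$. When $C_i$ arrives, if spot $\alpha_i$ is empty it parks there. Otherwise, independently with probability $1/2$ each: either (a) it backs up one spot, parking at $\alpha_i-1$ if $\alpha_i\ge 2$ and that spot is empty, and otherwise parking in the first empty spot among $\alpha_i+1,\ldots,n$; or (b) it parks in the first empty spot among $\alpha_i+1,\ldots,n$. If no empty spot is found the car fails to park. $\alpha$ parks if every car parks. -}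

module Defs where

open import Data.Nat using (ℕ; zero; suc; _<ᵇ_; _≡ᵇ_; _^_; _∸_) renaming (_*_ to _*ℕ_)
open import Data.Nat.Properties using (m^n≢0)
open import Data.Bool using (Bool; true; false; not; _∧_; if_then_else_)
open import Data.Fin using (Fin; toℕ)
open import Data.Vec using (Vec; lookup; replicate; _[_]≔_; toList)
open import Data.List using (List; allFin; findᵇ)
open import Data.Maybe using (Maybe; just; nothing)
open import Data.Integer using (+_)
open import Data.Rational using (ℚ; 0ℚ; 1ℚ; ½; _+_; _*_; _/_)

-- Spots 1..n are represented by Fin n (spot k+1 ↦ index k).
-- An occupancy state: true = occupied.
Occ : ℕ → Set
Occ n = Vec Bool n

isEmpty : ∀ {n} → Occ n → Fin n → Bool
isEmpty occ i = not (lookup occ i)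

forwardSpot : ∀ {n} → Occ n → Fin n → Maybe (Fin n)
forwardSpot {n} occ a = findᵇ (λ i → (toℕ a <ᵇ toℕ i) ∧ isEmpty occ i) (allFin n)

backSpot : ∀ {n} → Occ n → Fin n → Maybe (Fin n)
backSpot {n} occ a = findᵇ (λ i → (suc (toℕ i) ≡ᵇ toℕ a) ∧ isEmpty occ i) (allFin n)

optionA : ∀ {n} → Occ n → Fin n → Maybe (Fin n)
optionA occ a with backSpot occ a
... | just s  = just s
... | nothing = forwardSpot occ a

optionB : ∀ {n} → Occ n → Fin n → Maybe (Fin n)
optionB = forwardSpot

mutual
  probFrom : ∀ {n} → Occ n → List (Fin n) → ℚ
  probFrom occ List.[] = 1ℚ
  probFrom occ (a List.∷ as) =
    if isEmpty occ a
      then probFrom (occ [ a ]≔ true) as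
      else (½ * continue occ (optionA occ a) as + ½ * continue occ (optionB occ a) as)

  continue : ∀ {n} → Occ n → Maybe (Fin n) → List (Fin n) → ℚ
  continue occ nothing  as = 0ℚ
  continue occ (just s) as = probFrom (occ [ s ]≔ true) as

parkProb : ∀ {n} → Vec (Fin n) n → ℚ
parkProb {n} α = probFrom (replicate n false) (toList α)

target : ℕ → ℕ → ℚ
target n t = _/_ (+ (2 *ℕ t ∸ 1)) (2 ^ (n ∸ 1)) {{m^n≢0 2 (n ∸ 1)}}

-- Every random choice halves the probability, so P(α parks) = W(α) / 2^n for an integer weight W
-- in which a car that finds its preferred spot empty counts twice. Spots are numbered from 0.
-- After the first car the occupied spots always form an interval [L, R]. A car preferring a spot
-- outside the interval, inside it but not at L, or at L = 0, has two branches of equal weight (or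
-- one doubled branch), so it contributes an even factor; only a car preferring the left end L ≥ 1
-- splits the weight into "back to L − 1" plus "forward to R + 1". Following the odd summand shows
-- that W(α)/2 is odd exactly for the staircases α = (b, b, c₃, …, cₙ) with every cᵢ₊₁ ∈ {cᵢ, cᵢ − 1}
-- and b − 1 equal to the number of descents, and that then W(α) = 2 (1 + 2 code), where code reads
-- the steps without descent as binary digits. As code is a bijection from the 2^(n−2) step words
-- onto [0, 2^(n−2)), every value (2t − 1)/2^(n−1) is the parking probability of exactly one α.

module Submission where

open import Defs

open import Data.Bool using (Bool; true; false; not; _∧_; if_then_else_)
open import Data.Bool.Properties using (∧-zeroʳ)
open import Data.Fin as Fin using (Fin; toℕ)
import Data.Fin.Properties as Fin
open import Data.Integer as ℤ using (ℤ; +_)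
import Data.Integer.Properties as ℤ
import Data.Integer.Tactic.RingSolver as ℤ-Solver
open import Data.List as List using (List; []; _∷_; length; map; findᵇ; tabulate)
import Data.List.Properties as List
open import Data.Maybe using (Maybe; just; nothing)
open import Data.Nat as ℕ
  using (ℕ; zero; suc; _+_; _*_; _∸_; _^_; _≤_; _<_; _≤?_; _<?_; _≟_; s≤s; z≤n; NonZero; parity)
import Data.Nat.Properties as ℕ
open import Data.Nat.Tactic.RingSolver using (solve-∀)
open import Data.Parity.Base as ℙ using (0ℙ; 1ℙ)
import Data.Parity.Properties as ℙ
open import Data.Product using (Σ; _×_; _,_; proj₁; proj₂)
open import Data.Rational as ℚ using (ℚ; ½; toℚᵘ)
open import Data.Rational.Properties
  using (toℚᵘ-injective; toℚᵘ-fromℚᵘ; toℚᵘ-homo-+; toℚᵘ-homo-*; fromℚᵘ-cong; fromℚᵘ-injective; 0/n≡0)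
open import Data.Rational.Unnormalised as ℚᵘ using (mkℚᵘ; *≡*)
import Data.Rational.Unnormalised.Properties as ℚᵘ
open import Data.Sum using (_⊎_; inj₁; inj₂)
open import Data.Vec as Vec using (Vec; []; _∷_; lookup; replicate; _[_]≔_; toList)
import Data.Vec.Properties as Vec
open import Data.Vec.Relation.Binary.Equality.Cast using (cast-is-id)
open import Function using (_∘_; id)
open import Function.Bundles using (_⇔_; mk⇔; Equivalence)
open import Relation.Binary.Definitions using (tri<; tri≈; tri>)
open import Relation.Binary.PropositionalEquality
open import Relation.Nullary using (¬_; does; yes; no; contradiction)
open import Relation.Nullary.Decidable using (dec-true; dec-false)

open import Algebra.Properties.CommutativeSemigroup ℕ.*-commutativeSemigroup using (xy∙z≈y∙xz)

-- Dyadic rationals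

*≡*⇒/≡ : ∀ x y d e .{{_ : NonZero d}} .{{_ : NonZero e}} → x * e ≡ y * d → + x ℚ./ d ≡ + y ℚ./ e
*≡*⇒/≡ x y (suc d) (suc e) eq = fromℚᵘ-cong {mkℚᵘ (+ x) d} {mkℚᵘ (+ y) e}
  (*≡* (trans (sym (ℤ.pos-* x (suc e))) (trans (cong +_ eq) (ℤ.pos-* y (suc d)))))

/-injectiveˡ : ∀ x y d .{{_ : NonZero d}} → + x ℚ./ d ≡ + y ℚ./ d → x ≡ y
/-injectiveˡ x y (suc d) eq with fromℚᵘ-injective {mkℚᵘ (+ x) d} {mkℚᵘ (+ y) d} eq
... | *≡* e = ℕ.*-cancelʳ-≡ x y (suc d)
  (ℤ.+-injective (trans (ℤ.pos-* x (suc d)) (trans e (sym (ℤ.pos-* y (suc d))))))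

½*[x/d]≡x/[2*d] : ∀ x d .{{_ : NonZero d}} → ½ ℚ.* (+ x ℚ./ d) ≡ (+ x ℚ./ (2 * d)) {{ℕ.m*n≢0 2 d}}
½*[x/d]≡x/[2*d] x (suc d) = toℚᵘ-injective (begin
  toℚᵘ (½ ℚ.* (+ x ℚ./ suc d))      ≈⟨ toℚᵘ-homo-* ½ (+ x ℚ./ suc d) ⟩
  toℚᵘ ½ ℚᵘ.* toℚᵘ (+ x ℚ./ suc d)  ≈⟨ ℚᵘ.*-congˡ {toℚᵘ ½} (toℚᵘ-fromℚᵘ (mkℚᵘ (+ x) d)) ⟩
  toℚᵘ ½ ℚᵘ.* mkℚᵘ (+ x) d          ≈⟨ *≡* (cong (ℤ._* + (2 * suc d)) (ℤ.*-identityˡ (+ x))) ⟩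
  mkℚᵘ (+ x) (ℕ.pred (2 * suc d))   ≈⟨ ℚᵘ.≃-sym (toℚᵘ-fromℚᵘ _) ⟩
  toℚᵘ (+ x ℚ./ (2 * suc d))        ∎)
  where open ℚᵘ.≃-Reasoning

x/d+y/d≡[x+y]/d : ∀ x y d .{{_ : NonZero d}} → + x ℚ./ d ℚ.+ + y ℚ./ d ≡ + (x + y) ℚ./ d
x/d+y/d≡[x+y]/d x y (suc d) = toℚᵘ-injective (begin
  toℚᵘ (+ x ℚ./ suc d ℚ.+ + y ℚ./ suc d)
    ≈⟨ toℚᵘ-homo-+ (+ x ℚ./ suc d) (+ y ℚ./ suc d) ⟩
  toℚᵘ (+ x ℚ./ suc d) ℚᵘ.+ toℚᵘ (+ y ℚ./ suc d)
    ≈⟨ ℚᵘ.+-cong (toℚᵘ-fromℚᵘ (mkℚᵘ (+ x) d)) (toℚᵘ-fromℚᵘ (mkℚᵘ (+ y) d)) ⟩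
  mkℚᵘ (+ x) d ℚᵘ.+ mkℚᵘ (+ y) d
    ≈⟨ *≡* (trans (distrib (+ x) (+ y) (+ suc d)) (cong₂ ℤ._*_ (sym (ℤ.pos-+ x y)) (ℤ.pos-* (suc d) (suc d)))) ⟩
  mkℚᵘ (+ (x + y)) d
    ≈⟨ ℚᵘ.≃-sym (toℚᵘ-fromℚᵘ _) ⟩
  toℚᵘ (+ (x + y) ℚ./ suc d)
    ∎)
  where
  open ℚᵘ.≃-Reasoning
  distrib : ∀ (a b c : ℤ) → (a ℤ.* c ℤ.+ b ℤ.* c) ℤ.* c ≡ (a ℤ.+ b) ℤ.* (c ℤ.* c)
  distrib = ℤ-Solver.solve-∀

infix 8 _/2^_

_/2^_ : ℕ → ℕ → ℚ
x /2^ k = (+ x ℚ./ 2 ^ k) {{ℕ.m^n≢0 2 k}}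

/2^-injective : ∀ {x y} k → x /2^ k ≡ y /2^ k → x ≡ y
/2^-injective {x} {y} k = /-injectiveˡ x y (2 ^ k) {{ℕ.m^n≢0 2 k}}

[2*x]/2^[1+k]≡x/2^k : ∀ x k → (2 * x) /2^ suc k ≡ x /2^ k
[2*x]/2^[1+k]≡x/2^k x k = *≡*⇒/≡ (2 * x) x (2 ^ suc k) (2 ^ k) {{ℕ.m^n≢0 2 (suc k)}} {{ℕ.m^n≢0 2 k}}
  (xy∙z≈y∙xz 2 x (2 ^ k))

½*x/2^k+½*y/2^k≡[x+y]/2^[1+k] : ∀ x y k → ½ ℚ.* x /2^ k ℚ.+ ½ ℚ.* y /2^ k ≡ (x + y) /2^ suc k
½*x/2^k+½*y/2^k≡[x+y]/2^[1+k] x y k =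
  trans (cong₂ ℚ._+_ (½*[x/d]≡x/[2*d] x (2 ^ k)) (½*[x/d]≡x/[2*d] y (2 ^ k))) (x/d+y/d≡[x+y]/d x y (2 ^ suc k))
  where instance
        _ = ℕ.m^n≢0 2 k
        _ = ℕ.m^n≢0 2 (suc k)

-- Weights

mutual
  weight : ∀ {n} → Occ n → List (Fin n) → ℕ
  weight occ []       = 1
  weight occ (a ∷ as) =
    if isEmpty occ a
      then 2 * weight (occ [ a ]≔ true) as
      else continueWeight occ (optionA occ a) as + continueWeight occ (optionB occ a) as

  continueWeight : ∀ {n} → Occ n → Maybe (Fin n) → List (Fin n) → ℕ
  continueWeight occ nothing  as = 0
  continueWeight occ (just s) as = weight (occ [ s ]≔ true) as

mutual
  probFrom≡weight/2^length : ∀ {n} (occ : Occ n) as → probFrom occ as ≡ weight occ as /2^ length as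
  probFrom≡weight/2^length occ []       = refl
  probFrom≡weight/2^length occ (a ∷ as) with isEmpty occ a
  ... | true  = trans (probFrom≡weight/2^length (occ [ a ]≔ true) as)
                      (sym ([2*x]/2^[1+k]≡x/2^k (weight (occ [ a ]≔ true) as) (length as)))
  ... | false = trans (cong₂ (λ p q → ½ ℚ.* p ℚ.+ ½ ℚ.* q)
                             (continue≡continueWeight/2^length occ (optionA occ a) as)
                             (continue≡continueWeight/2^length occ (optionB occ a) as))
                      (½*x/2^k+½*y/2^k≡[x+y]/2^[1+k] (continueWeight occ (optionA occ a) as)
                                                     (continueWeight occ (optionB occ a) as) (length as))

  continue≡continueWeight/2^length : ∀ {n} (occ : Occ n) s as →
                                     continue occ s as ≡ continueWeight occ s as /2^ length as
  continue≡continueWeight/2^length occ nothing  as = sym (0/n≡0 (2 ^ length as) {{ℕ.m^n≢0 2 (length as)}})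
  continue≡continueWeight/2^length occ (just s) as = probFrom≡weight/2^length (occ [ s ]≔ true) as

parkProb≡weight/2^n : ∀ {n} (α : Vec (Fin n) n) → parkProb α ≡ weight (replicate n false) (toList α) /2^ n
parkProb≡weight/2^n {n} α = trans (probFrom≡weight/2^length (replicate n false) (toList α))
                                  (cong (weight (replicate n false) (toList α) /2^_) (Vec.length-toList α))

-- Interval occupancies

inside : ℕ → ℕ → ℕ → Bool
inside L R x = does (L ≤? x) ∧ does (x ≤? R)

interval : ∀ n → ℕ → ℕ → Occ n
interval n L R = Vec.tabulate (λ i → inside L R (toℕ i))

inside-≤-≤ : ∀ {L R x} → L ≤ x → x ≤ R → inside L R x ≡ true
inside-≤-≤ {L} {R} {x} L≤x x≤R rewrite dec-true (L ≤? x) L≤x | dec-true (x ≤? R) x≤R = refl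

inside-< : ∀ {L R x} → x < L → inside L R x ≡ false
inside-< {L} {R} {x} x<L rewrite dec-false (L ≤? x) (ℕ.<⇒≱ x<L) = refl

inside-> : ∀ {L R x} → R < x → inside L R x ≡ false
inside-> {L} {R} {x} R<x rewrite dec-false (x ≤? R) (ℕ.<⇒≱ R<x) = ∧-zeroʳ (does (L ≤? x))

inside-singleton : ∀ {b x} → x ≢ b → inside b b x ≡ false
inside-singleton {b} {x} x≢b with ℕ.<-cmp x b
... | tri< x<b _ _ = inside-< {R = b} x<b
... | tri≈ _ x≡b _ = contradiction x≡b x≢b
... | tri> _ _ b<x = inside-> {L = b} b<x

inside-sucˡ : ∀ {L R x} → x ≢ L → inside (suc L) R x ≡ inside L R x
inside-sucˡ {L} {R} {x} x≢L with ℕ.<-cmp x L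
... | tri< x<L _ _ rewrite dec-false (suc L ≤? x) (ℕ.<⇒≱ (ℕ.m<n⇒m<1+n x<L))
                         | dec-false (L ≤? x) (ℕ.<⇒≱ x<L) = refl
... | tri≈ _ x≡L _ = contradiction x≡L x≢L
... | tri> _ _ L<x rewrite dec-true (suc L ≤? x) L<x | dec-true (L ≤? x) (ℕ.<⇒≤ L<x) = refl

inside-sucʳ : ∀ {L R x} → x ≢ suc R → inside L R x ≡ inside L (suc R) x
inside-sucʳ {L} {R} {x} x≢R+1 with ℕ.<-cmp x (suc R)
... | tri< x<R+1 _ _ rewrite dec-true (x ≤? R) (ℕ.≤-pred x<R+1) | dec-true (x ≤? suc R) (ℕ.<⇒≤ x<R+1) = refl
... | tri≈ _ x≡R+1 _ = contradiction x≡R+1 x≢R+1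
... | tri> _ _ R+1<x rewrite dec-false (x ≤? R) (ℕ.<⇒≱ (ℕ.<-trans (ℕ.n<1+n R) R+1<x))
                           | dec-false (x ≤? suc R) (ℕ.<⇒≱ R+1<x) = refl

lookup-interval : ∀ {n} L R (i : Fin n) → lookup (interval n L R) i ≡ inside L R (toℕ i)
lookup-interval L R = Vec.lookup∘tabulate (λ i → inside L R (toℕ i))

isEmpty-interval-inside : ∀ {n L R} (i : Fin n) → L ≤ toℕ i → toℕ i ≤ R → isEmpty (interval n L R) i ≡ false
isEmpty-interval-inside {L = L} {R} i L≤i i≤R = cong not (trans (lookup-interval L R i) (inside-≤-≤ L≤i i≤R))

isEmpty-interval-outside : ∀ {n L R} (i : Fin n) → toℕ i < L ⊎ R < toℕ i → isEmpty (interval n L R) i ≡ true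
isEmpty-interval-outside {L = L} {R} i (inj₁ i<L) = cong not (trans (lookup-interval L R i) (inside-< {R = R} i<L))
isEmpty-interval-outside {L = L} {R} i (inj₂ R<i) = cong not (trans (lookup-interval L R i) (inside-> {L = L} R<i))

[]≔true≡interval : ∀ {n} L R (occ : Occ n) (s : Fin n) → inside L R (toℕ s) ≡ true →
                   (∀ i → i ≢ s → lookup occ i ≡ inside L R (toℕ i)) → occ [ s ]≔ true ≡ interval n L R
[]≔true≡interval L R occ s s-inside agree =
  trans (sym (Vec.tabulate∘lookup (occ [ s ]≔ true))) (Vec.tabulate-cong pointwise)
  where
  pointwise : ∀ i → lookup (occ [ s ]≔ true) i ≡ inside L R (toℕ i)
  pointwise i with i Fin.≟ s
  ... | yes refl = trans (Vec.lookup∘update i occ true) (sym s-inside)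
  ... | no i≢s   = trans (Vec.lookup∘update′ i≢s occ true) (agree i i≢s)

interval-singleton : ∀ {n} (b : Fin n) → replicate n false [ b ]≔ true ≡ interval n (toℕ b) (toℕ b)
interval-singleton b = []≔true≡interval (toℕ b) (toℕ b) _ b (inside-≤-≤ (ℕ.≤-refl {toℕ b}) ℕ.≤-refl)
  (λ i i≢b → trans (Vec.lookup-replicate i false) (sym (inside-singleton (i≢b ∘ Fin.toℕ-injective))))

interval-growˡ : ∀ {n L R} (s : Fin n) → toℕ s ≡ L → L ≤ R → interval n (suc L) R [ s ]≔ true ≡ interval n L R
interval-growˡ {L = L} {R} s s≡L L≤R =
  []≔true≡interval L R _ s (inside-≤-≤ (ℕ.≤-reflexive (sym s≡L)) (subst (_≤ R) (sym s≡L) L≤R))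
    (λ i i≢s → trans (lookup-interval (suc L) R i)
                     (inside-sucˡ {R = R} (λ i≡L → i≢s (Fin.toℕ-injective (trans i≡L (sym s≡L))))))

interval-growʳ : ∀ {n L R} (s : Fin n) → toℕ s ≡ suc R → L ≤ R → interval n L R [ s ]≔ true ≡ interval n L (suc R)
interval-growʳ {L = L} {R} s s≡R+1 L≤R =
  []≔true≡interval L (suc R) _ s (inside-≤-≤ (subst (L ≤_) (sym s≡R+1) (ℕ.m≤n⇒m≤1+n L≤R)) (ℕ.≤-reflexive s≡R+1))
    (λ i i≢s → trans (lookup-interval L R i)
                     (inside-sucʳ {L = L} (λ i≡R+1 → i≢s (Fin.toℕ-injective (trans i≡R+1 (sym s≡R+1))))))

findᵇ-tabulate-just : ∀ {A : Set} {m} (f : Fin m → A) (p : A → Bool) (i : Fin m) → p (f i) ≡ true →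
                      (∀ j → j Fin.< i → p (f j) ≡ false) → findᵇ p (tabulate f) ≡ just (f i)
findᵇ-tabulate-just {m = suc m} f p Fin.zero    hit _      rewrite hit = refl
findᵇ-tabulate-just {m = suc m} f p (Fin.suc i) hit before rewrite before Fin.zero (s≤s z≤n) =
  findᵇ-tabulate-just (f ∘ Fin.suc) p i hit (λ j j<i → before (Fin.suc j) (s≤s j<i))

findᵇ-tabulate-nothing : ∀ {A : Set} {m} (f : Fin m → A) (p : A → Bool) →
                         (∀ j → p (f j) ≡ false) → findᵇ p (tabulate f) ≡ nothing
findᵇ-tabulate-nothing {m = zero}  f p miss = refl
findᵇ-tabulate-nothing {m = suc m} f p miss rewrite miss Fin.zero =
  findᵇ-tabulate-nothing (f ∘ Fin.suc) p (miss ∘ Fin.suc)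

backSpot-zero : ∀ {n} (occ : Occ n) a → toℕ a ≡ 0 → backSpot occ a ≡ nothing
backSpot-zero occ a a≡0 =
  findᵇ-tabulate-nothing id _ (λ j → cong (λ k → (suc (toℕ j) ℕ.≡ᵇ k) ∧ isEmpty occ j) a≡0)

backSpot-interval : ∀ {n L R} (a s : Fin n) → toℕ a ≡ suc L → toℕ s ≡ L →
                    backSpot (interval n (suc L) R) a ≡ just s
backSpot-interval {n} {L} {R} a s a≡L+1 s≡L = findᵇ-tabulate-just id _ s
  (cong₂ _∧_ (dec-true (suc (toℕ s) ≟ toℕ a) (trans (cong suc s≡L) (sym a≡L+1)))
             (isEmpty-interval-outside s (inj₁ (s≤s (ℕ.≤-reflexive s≡L)))))
  (λ j j<s → cong (_∧ isEmpty (interval n (suc L) R) j) (dec-false (suc (toℕ j) ≟ toℕ a)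
     (λ j+1≡a → ℕ.<-irrefl (ℕ.suc-injective (trans j+1≡a (trans a≡L+1 (cong suc (sym s≡L))))) j<s)))

backSpot-interval-inner : ∀ {n L R} (a : Fin n) → L < toℕ a → toℕ a ≤ suc R →
                          backSpot (interval n L R) a ≡ nothing
backSpot-interval-inner {n} {L} {R} a L<a a≤R+1 = findᵇ-tabulate-nothing id _ blocked
  where
  blocked : ∀ j → (suc (toℕ j) ℕ.≡ᵇ toℕ a) ∧ isEmpty (interval n L R) j ≡ false
  blocked j with suc (toℕ j) ≟ toℕ a
  ... | no j+1≢a  = cong (_∧ isEmpty (interval n L R) j) (dec-false (suc (toℕ j) ≟ toℕ a) j+1≢a)
  ... | yes j+1≡a = trans (cong ((suc (toℕ j) ℕ.≡ᵇ toℕ a) ∧_)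
                                (isEmpty-interval-inside j (ℕ.≤-pred (subst (L <_) (sym j+1≡a) L<a))
                                                           (ℕ.≤-pred (subst (_≤ suc R) (sym j+1≡a) a≤R+1))))
                          (∧-zeroʳ _)

forward-blocked : ∀ {n L R} (a j : Fin n) → L ≤ toℕ a → toℕ j ≤ R →
                  (toℕ a ℕ.<ᵇ toℕ j) ∧ isEmpty (interval n L R) j ≡ false
forward-blocked {n} {L} {R} a j L≤a j≤R with toℕ a <? toℕ j
... | no a≮j  = cong (_∧ isEmpty (interval n L R) j) (dec-false (toℕ a <? toℕ j) a≮j)
... | yes a<j = trans (cong ((toℕ a ℕ.<ᵇ toℕ j) ∧_) (isEmpty-interval-inside j (ℕ.≤-trans L≤a (ℕ.<⇒≤ a<j)) j≤R))
                      (∧-zeroʳ _)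

forwardSpot-interval : ∀ {n L R} (a s : Fin n) → L ≤ toℕ a → toℕ a ≤ R → toℕ s ≡ suc R →
                       forwardSpot (interval n L R) a ≡ just s
forwardSpot-interval {n} {L} {R} a s L≤a a≤R s≡R+1 = findᵇ-tabulate-just id _ s
  (cong₂ _∧_ (dec-true (toℕ a <? toℕ s) (subst (toℕ a <_) (sym s≡R+1) (s≤s a≤R)))
             (isEmpty-interval-outside {L = L} s (inj₂ (ℕ.≤-reflexive (sym s≡R+1)))))
  (λ j j<s → forward-blocked a j L≤a (ℕ.≤-pred (subst (toℕ j <_) s≡R+1 j<s)))

forwardSpot-interval-full : ∀ {n L R} (a : Fin n) → L ≤ toℕ a → toℕ a ≤ R → suc R ≡ n →
                            forwardSpot (interval n L R) a ≡ nothing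
forwardSpot-interval-full {n} a L≤a a≤R R+1≡n = findᵇ-tabulate-nothing id _
  (λ j → forward-blocked a j L≤a (ℕ.≤-pred (subst (toℕ j <_) (sym R+1≡n) (Fin.toℕ<n j))))

weight-free : ∀ {n} (occ : Occ n) a as → isEmpty occ a ≡ true →
              weight occ (a ∷ as) ≡ 2 * weight (occ [ a ]≔ true) as
weight-free occ a as free rewrite free = refl

weight-taken : ∀ {n} (occ : Occ n) a as → isEmpty occ a ≡ false →
               weight occ (a ∷ as) ≡ continueWeight occ (optionA occ a) as + continueWeight occ (optionB occ a) as
weight-taken occ a as taken rewrite taken = refl

optionA-back : ∀ {n} (occ : Occ n) a s → backSpot occ a ≡ just s → optionA occ a ≡ just s
optionA-back occ a s back rewrite back = refl

optionA-forward : ∀ {n} (occ : Occ n) a → backSpot occ a ≡ nothing → optionA occ a ≡ forwardSpot occ a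
optionA-forward occ a noBack rewrite noBack = refl

rightWeight : ∀ n → ℕ → ℕ → List (Fin n) → ℕ
rightWeight n L R as with suc R <? n
... | yes _ = weight (interval n L (suc R)) as
... | no  _ = 0

rightWeight-room : ∀ {n L R} as → suc R < n → rightWeight n L R as ≡ weight (interval n L (suc R)) as
rightWeight-room {n} {L} {R} as R+1<n with suc R <? n
... | yes _    = refl
... | no R+1≮n = contradiction R+1<n R+1≮n

rightWeight-full : ∀ {n L R} as → suc R ≡ n → rightWeight n L R as ≡ 0
rightWeight-full {n} {L} {R} as R+1≡n with suc R <? n
... | yes R+1<n = contradiction R+1≡n (ℕ.<⇒≢ R+1<n)
... | no _      = refl

continueWeight-forwardSpot : ∀ {n L R} (a : Fin n) as → L ≤ toℕ a → toℕ a ≤ R → R < n →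
                             continueWeight (interval n L R) (forwardSpot (interval n L R) a) as ≡ rightWeight n L R as
continueWeight-forwardSpot {n} {L} {R} a as L≤a a≤R R<n with suc R <? n
... | yes R+1<n rewrite forwardSpot-interval a (Fin.fromℕ< R+1<n) L≤a a≤R (Fin.toℕ-fromℕ< R+1<n) =
  cong (λ occ → weight occ as) (interval-growʳ (Fin.fromℕ< R+1<n) (Fin.toℕ-fromℕ< R+1<n) (ℕ.≤-trans L≤a a≤R))
... | no R+1≮n rewrite forwardSpot-interval-full a L≤a a≤R (ℕ.≤∧≮⇒≡ R<n R+1≮n) = refl

weight-outside : ∀ {n L R} (a : Fin n) as → toℕ a < L ⊎ R < toℕ a →
                 weight (interval n L R) (a ∷ as) ≡ 2 * weight (interval n L R [ a ]≔ true) as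
weight-outside a as outside = weight-free _ a as (isEmpty-interval-outside a outside)

weight-adjacent : ∀ {n L R} (a : Fin n) as → toℕ a ≡ L → L ≤ R →
                  weight (interval n (suc L) R) (a ∷ as) ≡ 2 * weight (interval n L R) as
weight-adjacent a as a≡L L≤R =
  trans (weight-outside a as (inj₁ (ℕ.≤-reflexive (cong suc a≡L))))
        (cong (λ occ → 2 * weight occ as) (interval-growˡ a a≡L L≤R))

weight-leftEnd : ∀ {n L R} (a : Fin n) as → toℕ a ≡ suc L → suc L ≤ R → R < n →
                 weight (interval n (suc L) R) (a ∷ as) ≡ weight (interval n L R) as + rightWeight n (suc L) R as
weight-leftEnd {n} {L} {R} a as a≡L+1 L+1≤R R<n =
  trans (weight-taken _ a as (isEmpty-interval-inside a L+1≤a a≤R))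
        (cong₂ _+_ backBranch (continueWeight-forwardSpot a as L+1≤a a≤R R<n))
  where
  L+1≤a = ℕ.≤-reflexive (sym a≡L+1)
  a≤R = subst (_≤ R) (sym a≡L+1) L+1≤R
  L<n : L < n
  L<n = ℕ.<-trans (ℕ.<-≤-trans (ℕ.n<1+n L) L+1≤R) R<n
  s = Fin.fromℕ< L<n
  backBranch : continueWeight (interval n (suc L) R) (optionA (interval n (suc L) R) a) as ≡ weight (interval n L R) as
  backBranch =
    trans (cong (λ s → continueWeight _ s as) (optionA-back _ a s (backSpot-interval a s a≡L+1 (Fin.toℕ-fromℕ< L<n))))
          (cong (λ occ → weight occ as) (interval-growˡ s (Fin.toℕ-fromℕ< L<n) (ℕ.≤-trans (ℕ.n≤1+n L) L+1≤R)))

weight-forwardOnly : ∀ {n L R} (a : Fin n) as → L ≤ toℕ a → toℕ a ≤ R → R < n →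
                     backSpot (interval n L R) a ≡ nothing →
                     weight (interval n L R) (a ∷ as) ≡ rightWeight n L R as + rightWeight n L R as
weight-forwardOnly a as L≤a a≤R R<n noBack =
  trans (weight-taken _ a as (isEmpty-interval-inside a L≤a a≤R))
        (cong₂ _+_ (trans (cong (λ s → continueWeight _ s as) (optionA-forward _ a noBack)) forward) forward)
  where
  forward = continueWeight-forwardSpot a as L≤a a≤R R<n

weight-first : ∀ {n} (b : Fin n) cs → weight (replicate n false) (b ∷ cs) ≡ 2 * weight (interval n (toℕ b) (toℕ b)) cs
weight-first {n} b cs = trans (weight-free _ b cs (cong not (Vec.lookup-replicate b false)))
                              (cong (λ occ → 2 * weight occ cs) (interval-singleton b))

-- Parity

Odd : ℕ → Set
Odd w = parity w ≡ 1ℙ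

parity-2* : ∀ x → parity (2 * x) ≡ 0ℙ
parity-2* x = ℙ.*-homo-* 2 x

parity-x+x : ∀ x → parity (x + x) ≡ 0ℙ
parity-x+x x = trans (ℙ.+-homo-+ x x) (ℙ.p+p≡0ℙ (parity x))

odd-1+2* : ∀ x → Odd (1 + 2 * x)
odd-1+2* x = trans (ℙ.+-homo-+ 1 (2 * x)) (cong (1ℙ ℙ.+_) (parity-2* x))

odd-+ : ∀ x y → Odd (x + y) → Odd x ⊎ Odd y
odd-+ x y odd with parity x | parity y | ℙ.+-homo-+ x y
... | 1ℙ | _  | _  = inj₁ refl
... | 0ℙ | 1ℙ | _  = inj₂ refl
... | 0ℙ | 0ℙ | eq = contradiction (trans (sym odd) eq) λ ()

double-not-odd : ∀ {w} x → w ≡ 2 * x → ¬ Odd w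
double-not-odd x refl odd with () ← trans (sym (parity-2* x)) odd

sum-self-not-odd : ∀ {w} x → w ≡ x + x → ¬ Odd w
sum-self-not-odd x refl odd with () ← trans (sym (parity-x+x x)) odd

weight-odd⇒leftEnd : ∀ {n L R} (a : Fin n) as → R < n → Odd (weight (interval n L R) (a ∷ as)) →
                     toℕ a ≡ L × 0 < L
weight-odd⇒leftEnd {n} {L} {R} a as R<n odd with toℕ a ℕ.≤? R
... | no a≰R = contradiction odd (double-not-odd (weight (interval n L R [ a ]≔ true) as)
                                                 (weight-outside {L = L} {R} a as (inj₂ (ℕ.≰⇒> a≰R))))
... | yes a≤R with ℕ.<-cmp (toℕ a) L
...   | tri< a<L _ _ = contradiction odd (double-not-odd (weight (interval n L R [ a ]≔ true) as)
                                                         (weight-outside {L = L} {R} a as (inj₁ a<L)))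
...   | tri> _ _ L<a = contradiction odd (sum-self-not-odd (rightWeight n L R as)
          (weight-forwardOnly a as (ℕ.<⇒≤ L<a) a≤R R<n (backSpot-interval-inner a L<a (ℕ.m≤n⇒m≤1+n a≤R))))
...   | tri≈ _ a≡L _ = a≡L , ℕ.n≢0⇒n>0 (λ L≡0 → sum-self-not-odd (rightWeight n L R as)
          (weight-forwardOnly a as (ℕ.≤-reflexive (sym a≡L)) a≤R R<n (backSpot-zero (interval n L R) a (trans a≡L L≡0))) odd)

-- Staircase preference sequences

bit : Bool → ℕ
bit false = 0
bit true  = 1

staircase : ℕ → List Bool → List ℕ
staircase c []       = []
staircase c (δ ∷ ds) = c ∸ bit δ ∷ staircase (c ∸ bit δ) ds

descents : List Bool → ℕ
descents []       = 0
descents (δ ∷ ds) = bit δ + descents ds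

code : List Bool → ℕ
code []       = 0
code (δ ∷ ds) = bit (not δ) + 2 * code ds

descents≤length : ∀ ds → descents ds ≤ length ds
descents≤length []           = z≤n
descents≤length (true ∷ ds)  = s≤s (descents≤length ds)
descents≤length (false ∷ ds) = ℕ.m≤n⇒m≤1+n (descents≤length ds)

descents≡length⇒code≡0 : ∀ ds → descents ds ≡ length ds → code ds ≡ 0
descents≡length⇒code≡0 []           _  = refl
descents≡length⇒code≡0 (true ∷ ds)  eq = cong (2 *_) (descents≡length⇒code≡0 ds (ℕ.suc-injective eq))
descents≡length⇒code≡0 (false ∷ ds) eq = contradiction (descents≤length ds) (ℕ.<⇒≱ (ℕ.≤-reflexive (sym eq)))

length-staircase : ∀ c ds → length (staircase c ds) ≡ length ds
length-staircase c []       = refl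
length-staircase c (δ ∷ ds) = cong suc (length-staircase (c ∸ bit δ) ds)

-- In both lemmas the interval [L, R] is occupied and the remaining cars exactly fill the L + (n − 1 − R)
-- free spots. In weight-staircase the previous car preferred spot bit d + L.
mutual
  weight-staircase : ∀ {n} d ds L R (cs : List (Fin n)) →
    map toℕ cs ≡ staircase (bit d + L) ds → bit d + L ≡ suc (descents ds) →
    length ds + suc R ≡ L + n → bit d + L ≤ R → R < n →
    weight (interval n L R) cs ≡ bit d + code ds
  weight-staircase true  []           L       R []       _  _    _    _   _   = refl
  weight-staircase false []           L       R []       _  refl fill _   R<n = contradiction (ℕ.suc-injective fill) (ℕ.<⇒≢ R<n)
  weight-staircase false (true ∷ ds)  (suc L) R (a ∷ as) eq c    fill c≤R R<n =
    trans (weight-adjacent a as (List.∷-injectiveˡ eq) L≤R)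
          (cong (2 *_) (weight-staircase false ds L R as (List.∷-injectiveʳ eq) (ℕ.suc-injective c)
                                         (ℕ.suc-injective fill) L≤R R<n))
    where L≤R = ℕ.≤-trans (ℕ.n≤1+n L) c≤R
  weight-staircase false (false ∷ ds) L       R (a ∷ as) eq c    fill c≤R R<n =
    weight-leftEnd-staircase ds L R a as (List.∷-injectiveˡ eq) (List.∷-injectiveʳ eq) c fill c≤R R<n
  weight-staircase true  (true ∷ ds)  L       R (a ∷ as) eq c    fill c≤R R<n =
    weight-leftEnd-staircase ds L R a as (List.∷-injectiveˡ eq) (List.∷-injectiveʳ eq) (ℕ.suc-injective c) fill
                             (ℕ.≤-trans (ℕ.n≤1+n L) c≤R) R<n
  weight-staircase {n} true (false ∷ ds) L R (a ∷ as) eq c fill c≤R R<n with ℕ.m≤n⇒m<n∨m≡n R<n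
  ... | inj₁ R+1<n = begin
    weight (interval n L R) (a ∷ as)
      ≡⟨ weight-forwardOnly a as (ℕ.<⇒≤ L<a) a≤R R<n (backSpot-interval-inner a L<a (ℕ.m≤n⇒m≤1+n a≤R)) ⟩
    rightWeight n L R as + rightWeight n L R as
      ≡⟨ cong (λ w → w + w) (trans (rightWeight-room as R+1<n)
           (weight-staircase true ds L (suc R) as (List.∷-injectiveʳ eq) c (trans (ℕ.+-suc (length ds) (suc R)) fill)
                             (ℕ.m≤n⇒m≤1+n c≤R) R+1<n)) ⟩
    (1 + code ds) + (1 + code ds)
      ≡⟨ twice-succ (code ds) ⟩
    1 + (1 + 2 * code ds)
      ∎
    where
    open ≡-Reasoning
    L<a : L < toℕ a
    L<a = ℕ.≤-reflexive (sym (List.∷-injectiveˡ eq))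
    a≤R : toℕ a ≤ R
    a≤R = subst (_≤ R) (sym (List.∷-injectiveˡ eq)) c≤R
    twice-succ : ∀ x → (1 + x) + (1 + x) ≡ 1 + (1 + 2 * x)
    twice-succ = solve-∀
  ... | inj₂ R+1≡n = contradiction (descents≤length ds) (ℕ.<⇒≱ (subst (length ds <_) (ℕ.suc-injective c)
                                                                      (ℕ.≤-reflexive length+1≡L)))
    where
    length+1≡L : suc (length ds) ≡ L
    length+1≡L = ℕ.+-cancelʳ-≡ n (suc (length ds)) L (subst (λ k → suc (length ds) + k ≡ L + n) R+1≡n fill)

  weight-leftEnd-staircase : ∀ {n} ds L R (a : Fin n) as →
    toℕ a ≡ L → map toℕ as ≡ staircase L ds → L ≡ suc (descents ds) →
    suc (length ds) + suc R ≡ L + n → L ≤ R → R < n →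
    weight (interval n L R) (a ∷ as) ≡ 1 + 2 * code ds
  weight-leftEnd-staircase {n} ds .(suc (descents ds)) R a as a≡L eq refl fill L≤R R<n = begin
    weight (interval n (suc D) R) (a ∷ as)
      ≡⟨ weight-leftEnd a as a≡L L≤R R<n ⟩
    weight (interval n D R) as + rightWeight n (suc D) R as
      ≡⟨ cong₂ _+_ (weight-staircase true ds D R as eq refl (ℕ.suc-injective fill) L≤R R<n) forward ⟩
    (1 + code ds) + code ds
      ≡⟨ once-more (code ds) ⟩
    1 + 2 * code ds
      ∎
    where
    open ≡-Reasoning
    D = descents ds
    once-more : ∀ x → (1 + x) + x ≡ 1 + 2 * x
    once-more = solve-∀
    forward : rightWeight n (suc D) R as ≡ code ds
    forward with ℕ.m≤n⇒m<n∨m≡n R<n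
    ... | inj₁ R+1<n = trans (rightWeight-room as R+1<n)
      (weight-staircase false ds (suc D) (suc R) as eq refl (trans (ℕ.+-suc (length ds) (suc R)) fill)
                        (ℕ.m≤n⇒m≤1+n L≤R) R+1<n)
    ... | inj₂ R+1≡n = trans (rightWeight-full as R+1≡n) (sym (descents≡length⇒code≡0 ds (sym length≡D)))
      where
      length≡D : length ds ≡ D
      length≡D = ℕ.suc-injective (ℕ.+-cancelʳ-≡ n (suc (length ds)) (suc D)
                                                 (subst (λ k → suc (length ds) + k ≡ suc D + n) R+1≡n fill))

odd-weight⇒staircase : ∀ {n} L R (a : Fin n) as →
  suc (length as) + suc R ≡ L + n → L ≤ R → R < n → Odd (weight (interval n L R) (a ∷ as)) →
  Σ (List Bool) λ ds → L ≡ suc (descents ds) × map toℕ (a ∷ as) ≡ L ∷ staircase L ds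
odd-weight⇒staircase L R a as fill L≤R R<n odd with weight-odd⇒leftEnd {L = L} a as R<n odd
odd-weight⇒staircase zero    R a as fill L≤R R<n odd | _ , ()
odd-weight⇒staircase {n} (suc L) R a [] fill L≤R R<n odd | a≡L , _ = [] , cong suc L≡0 , cong (_∷ []) a≡L
  where
  L≡0 : L ≡ 0
  L≡0 = ℕ.n≤0⇒n≡0 (ℕ.+-cancelʳ-≤ n L 0 (subst (_≤ n) (ℕ.suc-injective fill) R<n))
odd-weight⇒staircase {n} (suc L) R a (a′ ∷ as) fill L≤R R<n odd | a≡L , _
  with odd-+ (weight (interval n L R) (a′ ∷ as)) (rightWeight n (suc L) R (a′ ∷ as))
             (subst Odd (weight-leftEnd a (a′ ∷ as) a≡L L≤R R<n) odd)
... | inj₁ backOdd with odd-weight⇒staircase L R a′ as (ℕ.suc-injective fill) (ℕ.≤-trans (ℕ.n≤1+n L) L≤R) R<n backOdd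
...   | ds , L≡ , eq = true ∷ ds , cong suc L≡ , cong₂ _∷_ a≡L eq
odd-weight⇒staircase {n} (suc L) R a (a′ ∷ as) fill L≤R R<n odd | a≡L , _ | inj₂ forwardOdd
  with ℕ.m≤n⇒m<n∨m≡n R<n
... | inj₂ R+1≡n = contradiction (subst Odd (rightWeight-full {L = suc L} (a′ ∷ as) R+1≡n) forwardOdd) λ ()
... | inj₁ R+1<n with odd-weight⇒staircase (suc L) (suc R) a′ as (trans (ℕ.+-suc (suc (length as)) (suc R)) fill)
                        (ℕ.m≤n⇒m≤1+n L≤R) R+1<n (subst Odd (rightWeight-room {L = suc L} (a′ ∷ as) R+1<n) forwardOdd)
...   | ds , L≡ , eq = false ∷ ds , L≡ , cong₂ _∷_ a≡L eq

-- Binary codes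

code-step-injective : ∀ δ ε x y → bit (not δ) + 2 * x ≡ bit (not ε) + 2 * y → δ ≡ ε × x ≡ y
code-step-injective true  true  x y eq = refl , ℕ.*-cancelˡ-≡ x y 2 eq
code-step-injective false false x y eq = refl , ℕ.*-cancelˡ-≡ x y 2 (ℕ.suc-injective eq)
code-step-injective true  false x y eq = contradiction eq (ℕ.even≢odd x y)
code-step-injective false true  x y eq = contradiction (sym eq) (ℕ.even≢odd y x)

code-injective : ∀ ds es → length ds ≡ length es → code ds ≡ code es → ds ≡ es
code-injective []       []       _   _  = refl
code-injective (δ ∷ ds) (ε ∷ es) len eq with code-step-injective δ ε (code ds) (code es) eq
... | refl , eq′ = cong (δ ∷_) (code-injective ds es (ℕ.suc-injective len) eq′)

halve : ∀ v → Σ Bool λ δ → Σ ℕ λ w → v ≡ bit (not δ) + 2 * w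
halve zero          = true , 0 , refl
halve (suc zero)    = false , 0 , refl
halve (suc (suc v)) with halve v
... | δ , w , v≡ = δ , suc w , trans (cong (λ u → 2 + u) v≡) (shift (bit (not δ)) w)
  where
  shift : ∀ b w → 2 + (b + 2 * w) ≡ b + 2 * (1 + w)
  shift = solve-∀

code-surjective : ∀ m v → v < 2 ^ m → Σ (Vec Bool m) λ ds → code (toList ds) ≡ v
code-surjective zero    zero    _           = [] , refl
code-surjective zero    (suc v) (s≤s ())
code-surjective (suc m) v       v<2^[m+1] with halve v
... | δ , w , v≡ with code-surjective m w (ℕ.*-cancelˡ-< 2 w (2 ^ m) (ℕ.≤-<-trans 2w≤v v<2^[m+1]))
  where
  2w≤v : 2 * w ≤ v
  2w≤v = subst (2 * w ≤_) (sym v≡) (ℕ.m≤n+m (2 * w) (bit (not δ)))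
...   | ds , code≡w = δ ∷ ds , trans (cong (λ c → bit (not δ) + 2 * c) code≡w) (sym v≡)

stepDown : ∀ {n} → Bool → Fin n → Fin n
stepDown false c = c
stepDown true  c = Fin.pred c

toℕ-stepDown : ∀ {n} δ (c : Fin n) → toℕ (stepDown δ c) ≡ toℕ c ∸ bit δ
toℕ-stepDown false c           = refl
toℕ-stepDown true  Fin.zero    = refl
toℕ-stepDown true  (Fin.suc i) = Fin.toℕ-inject₁ i

staircaseVec : ∀ {n k} → Fin n → Vec Bool k → Vec (Fin n) k
staircaseVec c []       = []
staircaseVec c (δ ∷ ds) = stepDown δ c ∷ staircaseVec (stepDown δ c) ds

map-toℕ-staircaseVec : ∀ {n k} (c : Fin n) (ds : Vec Bool k) →
                       map toℕ (toList (staircaseVec c ds)) ≡ staircase (toℕ c) (toList ds)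
map-toℕ-staircaseVec c []       = refl
map-toℕ-staircaseVec c (δ ∷ ds) = cong₂ _∷_ (toℕ-stepDown δ c)
  (trans (map-toℕ-staircaseVec (stepDown δ c) ds) (cong (λ c′ → staircase c′ (toList ds)) (toℕ-stepDown δ c)))

map-toℕ∘toList-injective : ∀ {n k} (u v : Vec (Fin n) k) → map toℕ (toList u) ≡ map toℕ (toList v) → u ≡ v
map-toℕ∘toList-injective u v eq =
  trans (sym (cast-is-id refl u)) (Vec.toList-injective refl u v (List.map-injective Fin.toℕ-injective eq))

preferences : List Bool → List ℕ
preferences ds = b ∷ b ∷ staircase b ds
  where b = suc (descents ds)

length-preferences : ∀ {n m} (γ : Vec (Fin n) (2 + m)) ds → map toℕ (toList γ) ≡ preferences ds → length ds ≡ m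
length-preferences γ ds eq = ℕ.suc-injective (ℕ.suc-injective (begin
  2 + length ds                ≡⟨ cong (λ k → 2 + k) (sym (length-staircase _ ds)) ⟩
  length (preferences ds)      ≡⟨ cong length (sym eq) ⟩
  length (map toℕ (toList γ))  ≡⟨ List.length-map toℕ (toList γ) ⟩
  length (toList γ)            ≡⟨ Vec.length-toList γ ⟩
  2 + _                        ∎))
  where open ≡-Reasoning

cars≡freeSpots : ∀ m b → suc m + suc b ≡ b + (2 + m)
cars≡freeSpots = solve-∀

weight-preferences : ∀ {m} (γ : List (Fin (2 + m))) ds → map toℕ γ ≡ preferences ds → length ds ≡ m →
                     weight (replicate (2 + m) false) γ ≡ 2 * (1 + 2 * code ds)
weight-preferences {m} (g ∷ c ∷ cs) ds eq refl = begin
  weight (replicate N false) (g ∷ c ∷ cs)           ≡⟨ weight-first g (c ∷ cs) ⟩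
  2 * weight (interval N (toℕ g) (toℕ g)) (c ∷ cs)  ≡⟨ cong (λ L → 2 * weight (interval N L L) (c ∷ cs)) g≡b ⟩
  2 * weight (interval N b b) (c ∷ cs)              ≡⟨ cong (2 *_) (weight-leftEnd-staircase ds b b c cs c≡b cs≡ refl
                                                          (cars≡freeSpots (length ds) b) ℕ.≤-refl b<N) ⟩
  2 * (1 + 2 * code ds)                             ∎
  where
  open ≡-Reasoning
  N = 2 + m
  b = suc (descents ds)
  g≡b = List.∷-injectiveˡ eq
  c≡b = List.∷-injectiveˡ (List.∷-injectiveʳ eq)
  cs≡ = List.∷-injectiveʳ (List.∷-injectiveʳ eq)
  b<N = subst (_< N) g≡b (Fin.toℕ<n g)

odd-weight⇒preferences : ∀ {m} (β : Vec (Fin (2 + m)) (2 + m)) t →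
                         weight (replicate (2 + m) false) (toList β) ≡ 2 * (1 + 2 * t) →
                         Σ (List Bool) λ ds → map toℕ (toList β) ≡ preferences ds
odd-weight⇒preferences {m} (g ∷ c ∷ cs) t w≡ =
  ds , subst (λ b → toℕ g ∷ map toℕ (c ∷ toList cs) ≡ b ∷ b ∷ staircase b ds) g≡b (cong (toℕ g ∷_) eq)
  where
  w = weight (interval (2 + m) (toℕ g) (toℕ g)) (c ∷ toList cs)
  w≡1+2t : w ≡ 1 + 2 * t
  w≡1+2t = ℕ.*-cancelˡ-≡ w (1 + 2 * t) 2 (trans (sym (weight-first g (c ∷ toList cs))) w≡)
  fill : suc (length (toList cs)) + suc (toℕ g) ≡ toℕ g + (2 + m)
  fill = trans (cong (λ k → suc k + suc (toℕ g)) (Vec.length-toList cs)) (cars≡freeSpots m (toℕ g))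
  found = odd-weight⇒staircase (toℕ g) (toℕ g) c (toList cs) fill ℕ.≤-refl (Fin.toℕ<n g)
                               (subst Odd (sym w≡1+2t) (odd-1+2* t))
  ds = proj₁ found
  g≡b = proj₁ (proj₂ found)
  eq = proj₂ (proj₂ found)

weight-determines-preferences : ∀ {m} (β : Vec (Fin (2 + m)) (2 + m)) (bits : Vec Bool m) →
                                weight (replicate (2 + m) false) (toList β) ≡ 2 * (1 + 2 * code (toList bits)) →
                                map toℕ (toList β) ≡ preferences (toList bits)
weight-determines-preferences β bits w≡ = trans β≡ (cong preferences ds≡bits)
  where
  found = odd-weight⇒preferences β (code (toList bits)) w≡
  ds = proj₁ found
  β≡ = proj₂ found
  ds-length = length-preferences β ds β≡
  code≡ : code ds ≡ code (toList bits)
  code≡ = ℕ.*-cancelˡ-≡ _ _ 2 (ℕ.suc-injective (ℕ.*-cancelˡ-≡ _ _ 2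
            (trans (sym (weight-preferences (toList β) ds β≡ ds-length)) w≡)))
  ds≡bits = code-injective ds (toList bits) (trans ds-length (sym (Vec.length-toList bits))) code≡

canonicalPreferences : ∀ {m} → Vec Bool m → Vec (Fin (2 + m)) (2 + m)
canonicalPreferences ds = b ∷ b ∷ staircaseVec b ds
  where b = Fin.fromℕ< (s≤s (s≤s (subst (descents (toList ds) ≤_) (Vec.length-toList ds) (descents≤length (toList ds)))))

map-toℕ-canonicalPreferences : ∀ {m} (ds : Vec Bool m) →
                               map toℕ (toList (canonicalPreferences ds)) ≡ preferences (toList ds)
map-toℕ-canonicalPreferences ds =
  cong₂ _∷_ b≡ (cong₂ _∷_ b≡ (trans (map-toℕ-staircaseVec _ ds) (cong (λ c → staircase c (toList ds)) b≡)))
  where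
  b≡ = Fin.toℕ-fromℕ< (s≤s (s≤s (subst (descents (toList ds) ≤_) (Vec.length-toList ds) (descents≤length (toList ds)))))

2*[1+t]∸1≡1+2*t : ∀ t → 2 * suc t ∸ 1 ≡ 1 + 2 * t
2*[1+t]∸1≡1+2*t t = ℕ.+-suc t (t + 0)

parkProb≡target⇔weight : ∀ {m} (β : Vec (Fin (2 + m)) (2 + m)) t →
  parkProb β ≡ target (2 + m) (suc t) ⇔ weight (replicate (2 + m) false) (toList β) ≡ 2 * (1 + 2 * t)
parkProb≡target⇔weight {m} β t = mk⇔
  (λ parks → /2^-injective (2 + m) (trans (sym (parkProb≡weight/2^n β)) (trans parks target≡)))
  (λ w≡ → trans (parkProb≡weight/2^n β) (trans (cong (_/2^ (2 + m)) w≡) (sym target≡)))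
  where
  target≡ : target (2 + m) (suc t) ≡ (2 * (1 + 2 * t)) /2^ (2 + m)
  target≡ = trans (cong (_/2^ suc m) (2*[1+t]∸1≡1+2*t t)) (sym ([2*x]/2^[1+k]≡x/2^k (1 + 2 * t) (suc m)))

theorem2 : (n : ℕ) → 1 ≤ n → (t : ℕ) → 1 ≤ t → 2 * t ≤ 2 ^ (n ∸ 1) →
    Σ (Vec (Fin n) n) (λ α → (parkProb α ≡ target n t) × ((β : Vec (Fin n) n) → parkProb β ≡ target n t → β ≡ α))
theorem2 n             _ zero    () _
theorem2 (suc zero)    _ (suc t) _  2t≤1 = contradiction 2t≤1 (ℕ.<⇒≱ (ℕ.*-monoʳ-≤ 2 (s≤s (z≤n {t}))))
theorem2 (suc (suc m)) _ (suc t) _  2t≤2^[m+1] with code-surjective m t (ℕ.*-cancelˡ-≤ 2 2t≤2^[m+1])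
... | bits , code≡t = α , Equivalence.from (parkProb≡target⇔weight α t) α-weight , α-unique
  where
  α = canonicalPreferences bits
  α-weight : weight (replicate (2 + m) false) (toList α) ≡ 2 * (1 + 2 * t)
  α-weight = trans (weight-preferences (toList α) (toList bits) (map-toℕ-canonicalPreferences bits)
                                       (Vec.length-toList bits))
                   (cong (λ c → 2 * (1 + 2 * c)) code≡t)
  α-unique : (β : Vec (Fin (2 + m)) (2 + m)) → parkProb β ≡ target (2 + m) (suc t) → β ≡ α
  α-unique β β-parks = map-toℕ∘toList-injective β α (begin
    map toℕ (toList β)        ≡⟨ weight-determines-preferences β bits
                                   (trans (Equivalence.to (parkProb≡target⇔weight β t) β-parks)
                                          (cong (λ c → 2 * (1 + 2 * c)) (sym code≡t))) ⟩
    preferences (toList bits) ≡⟨ sym (map-toℕ-canonicalPreferences bits) ⟩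
    map toℕ (toList α)        ∎)
    where open ≡-Reasoning
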